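{- Let $n,g,k$ be integers with $k\ge 1$ and $1\leq g\leq \left\lfloor \frac{n-k-2}{2}\right\rfloor$. Let $r\ge 0$ and $x$ be integers with $g+1\leq x\leq 2g$ and $n-k=(g+1)r+x+1$. Let $K_{1,g}^1,\ldots,K_{1,g}^{r}$ be stars with $g$ leaves and centers $v_1,\ldots,v_r$, let $K_{1,x}^{r+1}$ be a star with $x$ leaves and center $v_{r+1}$, and let $w,u_1,\ldots,u_{k-1}$ be further vertices (all disjoint). Let $T_n'$ be the tree of order $n$ obtained from these stars and vertices by adding the edges $wu_i$ ($1\le i\le k-1$) and $wv_i$ ($1\le i\le r+1$). Then $$\kappa_g(T_n')=k.$$
   Context: A set $S$ of vertices is a cutset if $G-S$ is disconnected; for a non-negative integer $g$, a cutset is an $R_g$-cutset if every component of $G-S$ has at least $g+1$ vertices. If $G$ has an $R_g$-cutset, $\kappa_g(G)$ is the minimum cardinality of an $R_g$-cutset of $G$. -}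

module Defs where

open import Data.Nat using (ℕ; suc; _≤_)
open import Data.Fin using (Fin; fromℕ; inject₁)
open import Data.List using (List; length)
open import Data.List.Membership.Propositional using (_∉_)
open import Data.List.Relation.Unary.All using (All)
open import Data.List.Relation.Unary.Unique.Propositional using (Unique)
open import Data.Product using (Σ; _×_; ∃)
open import Data.Sum using (_⊎_)
open import Relation.Nullary using (¬_)
open import Relation.Binary.PropositionalEquality using (_≡_)

-- Generic simple-graph notions.  A graph is a vertex type V with an
-- adjacency relation Adj.  A vertex set S is a duplicate-free list of
-- vertices (so |S| = length S).

module _ {V : Set} (Adj : V → V → Set) where

  data Reach (S : List V) (a : V) : V → Set where
    here : a ∉ S → Reach S a a
    step : ∀ {b c} → Reach S a b → Adj b c → c ∉ S → Reach S a c

  IsCutset : List V → Set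
  IsCutset S = Σ V λ a → Σ V λ b → a ∉ S × b ∉ S × ¬ Reach S a b

  -- every component of G - S has at least g+1 vertices: the component
  -- of each vertex a of G - S contains g+1 distinct vertices.
  ComponentsAtLeast : ℕ → List V → Set
  ComponentsAtLeast m S =
    ∀ a → a ∉ S → Σ (List V) λ L → Unique L × length L ≡ m × All (Reach S a) L

  IsRgCutset : ℕ → List V → Set
  IsRgCutset g S = IsCutset S × ComponentsAtLeast (suc g) S

  KappaIs : ℕ → ℕ → Set
  KappaIs g k =
    (Σ (List V) λ S → Unique S × length S ≡ k × IsRgCutset g S)
    × (∀ S → Unique S → IsRgCutset g S → k ≤ length S)

-- The tree T'_n.  Parameters k r g x; u has k-1 vertices, centers
-- v_1..v_{r+1} are ctr i (i : Fin (r+1)), the last one ctr (fromℕ r)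
-- is the center of the star K_{1,x}.

data TV (k r g x : ℕ) : Set where
  w     : TV k r g x
  u     : Fin (k Data.Nat.∸ 1) → TV k r g x
  ctr   : Fin (suc r) → TV k r g x
  leaf  : Fin r → Fin g → TV k r g x
  leafx : Fin x → TV k r g x

-- one orientation of each edge
data TEdge {k r g x : ℕ} : TV k r g x → TV k r g x → Set where
  w-u     : ∀ i → TEdge w (u i)
  w-ctr   : ∀ i → TEdge w (ctr i)
  ctr-leaf : ∀ i j → TEdge (ctr (inject₁ i)) (leaf i j)
  ctr-leafx : ∀ j → TEdge (ctr (fromℕ r)) (leafx j)

TAdj : ∀ {k r g x} → TV k r g x → TV k r g x → Set
TAdj a b = TEdge a b ⊎ TEdge b a

-- If w ∉ S, every vertex outside S reaches w: a leaf whose centre lies in S would be a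
-- singleton component, impossible since g ≥ 1.  So an R_g-cutset contains w, and then every
-- u_i, which would otherwise be isolated; hence it has at least k vertices.  Conversely,
-- deleting w and the u_i leaves the r + 1 ≥ 2 stars, each with at least g + 1 vertices.

module Submission where

open import Defs
open import Data.Nat using (ℕ; suc; _+_; _*_; _∸_; _/_; _≤_)
open import Relation.Binary.PropositionalEquality using (_≡_)

open import Data.Nat using (zero; _<_; z≤n; s≤s)
open import Data.Nat.Properties using (*-comm; *-zeroʳ; +-comm; *-monoˡ-≤; <⇒≤; <⇒≱; n<1+n; module ≤-Reasoning)
open import Data.Nat.DivMod using (m/n*n≤m)
open import Data.Fin using (Fin; zero; suc; fromℕ; fromℕ<; inject₁; inject≤)
open import Data.Fin.Properties using (injective⇒≤; inject≤-injective; fromℕ≢inject₁)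
import Data.Fin.Properties as Fin
open import Data.Fin.Relation.Unary.Top using (view; ‵fromℕ; ‵inject₁)
open import Data.Unit using (⊤; tt)
import Data.Unit.Properties as Unit
open import Data.Sum using (_⊎_; inj₁; inj₂; swap)
import Data.Sum.Properties as Sum
open import Data.Product using (Σ; _×_; _,_)
import Data.Product.Properties as Product
open import Data.List using (List; _∷_; length; tabulate)
open import Data.List.Properties using (length-tabulate)
open import Data.List.Relation.Unary.All using (All; _∷_)
import Data.List.Relation.Unary.All as All
import Data.List.Relation.Unary.All.Properties as All
open import Data.List.Relation.Unary.AllPairs using (_∷_)
open import Data.List.Relation.Unary.Any using (here)
open import Data.List.Relation.Unary.Unique.Propositional using (Unique)
import Data.List.Relation.Unary.Unique.Propositional.Properties as Unique
open import Data.List.Membership.Propositional using (_∈_; _∉_)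
open import Data.List.Membership.Propositional.Properties using (∈-tabulate⁺; ∈-tabulate⁻)
open import Data.List.Membership.Setoid.Properties using (index-injective)
import Data.List.Membership.DecPropositional as DecMembership
open import Function.Definitions using (Injective)
open import Relation.Nullary using (¬_; contradiction)
open import Relation.Nullary.Decidable using (map′; decidable-stable)
open import Relation.Binary.Definitions using (Symmetric; DecidableEquality)
open import Relation.Binary.PropositionalEquality using (refl; sym; trans; cong; subst; setoid; _≢_)

module _ {A : Set} where

  injection⇒≤length : ∀ {m} {xs : List A} (f : Fin m → A) → Injective _≡_ _≡_ f →
                      (∀ i → f i ∈ xs) → m ≤ length xs
  injection⇒≤length f f-injective f∈xs = injective⇒≤ λ {i} {j} same-index →
    f-injective (index-injective (setoid A) (f∈xs i) (f∈xs j) same-index)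

module _ {V : Set} (Adj : V → V → Set) where

  ComponentAtLeast : ℕ → List V → V → Set
  ComponentAtLeast m S a = Σ (List V) λ L → Unique L × length L ≡ m × All (Reach Adj S a) L

  private variable
    m : ℕ
    S : List V
    a b c h : V

  Reach-target∉ : Reach Adj S a b → b ∉ S
  Reach-target∉ (here a∉S) = a∉S
  Reach-target∉ (step _ _ c∉S) = c∉S

  Reach-trans : Reach Adj S a b → Reach Adj S b c → Reach Adj S a c
  Reach-trans a⇝b (here _) = a⇝b
  Reach-trans a⇝b (step b⇝c c~d d∉S) = step (Reach-trans a⇝b b⇝c) c~d d∉S

  Reach-sym : Symmetric Adj → Reach Adj S a b → Reach Adj S b a
  Reach-sym _ (here a∉S) = here a∉S
  Reach-sym adj-sym (step a⇝b b~c c∉S) =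
    Reach-trans (step (here c∉S) (adj-sym b~c) (Reach-target∉ a⇝b)) (Reach-sym adj-sym a⇝b)

  Reach-invariant : {B : Set} (f : V → B) →
                    (∀ {b c} → Adj b c → b ∉ S → c ∉ S → f b ≡ f c) →
                    Reach Adj S a c → f a ≡ f c
  Reach-invariant f _ (here _) = refl
  Reach-invariant f f-edge (step a⇝b b~c c∉S) =
    trans (Reach-invariant f f-edge a⇝b) (f-edge b~c (Reach-target∉ a⇝b) c∉S)

  hub⇒¬IsCutset : Symmetric Adj → (∀ a → a ∉ S → Reach Adj S a h) → ¬ IsCutset Adj S
  hub⇒¬IsCutset adj-sym reach-hub (a , b , a∉S , b∉S , a↛b) =
    a↛b (Reach-trans (reach-hub a a∉S) (Reach-sym adj-sym (reach-hub b b∉S)))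

  ComponentAtLeast-resp-Reach : Reach Adj S a b → ComponentAtLeast m S b → ComponentAtLeast m S a
  ComponentAtLeast-resp-Reach a⇝b (L , L-unique , L-length , b⇝L) =
    L , L-unique , L-length , All.map (Reach-trans a⇝b) b⇝L

  star-component : a ∉ S → (f : Fin m → V) → Injective _≡_ _≡_ f → (∀ j → a ≢ f j) →
                   (∀ j → Adj a (f j)) → (∀ j → f j ∉ S) → ComponentAtLeast (suc m) S a
  star-component {a = a} a∉S f f-injective a≢f a~f f∉S =
    a ∷ tabulate f ,
    All.tabulate⁺ a≢f ∷ Unique.tabulate⁺ f-injective ,
    cong suc (length-tabulate f) ,
    here a∉S ∷ All.tabulate⁺ λ j → step (here a∉S) (a~f j) (f∉S j)

  -- Otherwise a would be a singleton component of G − S.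
  pendant-neighbour∉ : 1 ≤ m → (∀ a → a ∉ S → ComponentAtLeast (suc m) S a) →
                       a ∉ S → (∀ {c} → Adj a c → c ≡ h) → h ∉ S
  pendant-neighbour∉ {S = S} {a = a} (s≤s z≤n) large a∉S only-h h∈S with large _ a∉S
  ... | b ∷ c ∷ _ , (b≢c ∷ _) ∷ _ , _ , a⇝b ∷ a⇝c ∷ _ =
    b≢c (trans (isolated a⇝b) (sym (isolated a⇝c)))
    where
    isolated : ∀ {c} → Reach Adj S a c → c ≡ a
    isolated (here _) = refl
    isolated (step a⇝b b~c c∉S) with isolated a⇝b
    ... | refl = contradiction (subst (_∈ S) (sym (only-h b~c)) h∈S) c∉S

-- m = k − 1 is the number of pendant vertices u_i.
module Tree (m r g x : ℕ) where

  V : Set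
  V = TV (suc m) r g x

  Adj : V → V → Set
  Adj = TAdj {suc m} {r} {g} {x}

  private variable
    S : List V

  Adj-sym : Symmetric Adj
  Adj-sym = swap

  Code : Set
  Code = ⊤ ⊎ Fin m ⊎ Fin (suc r) ⊎ (Fin r × Fin g) ⊎ Fin x

  encode : V → Code
  encode w          = inj₁ tt
  encode (u i)      = inj₂ (inj₁ i)
  encode (ctr i)    = inj₂ (inj₂ (inj₁ i))
  encode (leaf i j) = inj₂ (inj₂ (inj₂ (inj₁ (i , j))))
  encode (leafx j)  = inj₂ (inj₂ (inj₂ (inj₂ j)))

  decode : Code → V
  decode (inj₁ tt)                           = w
  decode (inj₂ (inj₁ i))                     = u i
  decode (inj₂ (inj₂ (inj₁ i)))              = ctr i
  decode (inj₂ (inj₂ (inj₂ (inj₁ (i , j))))) = leaf i j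
  decode (inj₂ (inj₂ (inj₂ (inj₂ j))))       = leafx j

  decode-encode : ∀ v → decode (encode v) ≡ v
  decode-encode w          = refl
  decode-encode (u _)      = refl
  decode-encode (ctr _)    = refl
  decode-encode (leaf _ _) = refl
  decode-encode (leafx _)  = refl

  encode-injective : Injective _≡_ _≡_ encode
  encode-injective {a} {b} eq =
    trans (sym (decode-encode a)) (trans (cong decode eq) (decode-encode b))

  _≟_ : DecidableEquality V
  a ≟ b = map′ encode-injective (cong encode) (encode a ≟ᶜ encode b)
    where
    _≟ᶜ_ : DecidableEquality Code
    _≟ᶜ_ = Sum.≡-dec Unit._≟_ (Sum.≡-dec Fin._≟_ (Sum.≡-dec Fin._≟_
             (Sum.≡-dec (Product.≡-dec Fin._≟_ Fin._≟_) Fin._≟_)))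

  open DecMembership _≟_ using (_∈?_)

  u-neighbour : ∀ {i c} → Adj (u i) c → c ≡ w
  u-neighbour (inj₂ (w-u _)) = refl

  leaf-neighbour : ∀ {i j c} → Adj (leaf i j) c → c ≡ ctr (inject₁ i)
  leaf-neighbour (inj₂ (ctr-leaf _ _)) = refl

  leafx-neighbour : ∀ {j c} → Adj (leafx j) c → c ≡ ctr (fromℕ r)
  leafx-neighbour (inj₂ (ctr-leafx _)) = refl

  module _ (1≤g : 1 ≤ g) where

    reaches-w : ComponentsAtLeast Adj (suc g) S → w ∉ S → ∀ a → a ∉ S → Reach Adj S a w
    reaches-w _ _ w a∉S = here a∉S
    reaches-w _ w∉S (u i) a∉S = step (here a∉S) (inj₂ (w-u i)) w∉S
    reaches-w _ w∉S (ctr i) a∉S = step (here a∉S) (inj₂ (w-ctr i)) w∉S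
    reaches-w large w∉S (leaf i j) a∉S =
      step (step (here a∉S) (inj₂ (ctr-leaf i j)) (pendant-neighbour∉ Adj 1≤g large a∉S leaf-neighbour))
           (inj₂ (w-ctr _)) w∉S
    reaches-w large w∉S (leafx j) a∉S =
      step (step (here a∉S) (inj₂ (ctr-leafx j)) (pendant-neighbour∉ Adj 1≤g large a∉S leafx-neighbour))
           (inj₂ (w-ctr _)) w∉S

    w∈Rg-cutset : IsRgCutset Adj g S → w ∈ S
    w∈Rg-cutset {S} (cut , large) = decidable-stable (w ∈? S) λ w∉S →
      hub⇒¬IsCutset Adj Adj-sym (reaches-w large w∉S) cut

    u∈Rg-cutset : IsRgCutset Adj g S → ∀ i → u i ∈ S
    u∈Rg-cutset {S} rg@(_ , large) i = decidable-stable (u i ∈? S) λ ui∉S →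
      pendant-neighbour∉ Adj 1≤g large ui∉S u-neighbour (w∈Rg-cutset rg)

  separatorAt : Fin (suc m) → V
  separatorAt zero    = w
  separatorAt (suc i) = u i

  separatorAt-injective : Injective _≡_ _≡_ separatorAt
  separatorAt-injective {zero}  {zero}  _    = refl
  separatorAt-injective {suc _} {suc _} refl = refl

  separator : List V
  separator = tabulate separatorAt

  Rg-cutset-length : 1 ≤ g → IsRgCutset Adj g S → suc m ≤ length S
  Rg-cutset-length 1≤g rg = injection⇒≤length separatorAt separatorAt-injective λ where
    zero    → w∈Rg-cutset 1≤g rg
    (suc i) → u∈Rg-cutset 1≤g rg i

  w∈separator : w ∈ separator
  w∈separator = ∈-tabulate⁺ {f = separatorAt} zero

  ∉separator : ∀ {v} → (∀ i → v ≢ separatorAt i) → v ∉ separator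
  ∉separator v≢separator v∈separator with ∈-tabulate⁻ v∈separator
  ... | i , v≡separatorAt-i = v≢separator i v≡separatorAt-i

  ctr∉separator : ∀ {i} → ctr i ∉ separator
  ctr∉separator = ∉separator λ { zero (); (suc _) () }

  leaf∉separator : ∀ {i j} → leaf i j ∉ separator
  leaf∉separator = ∉separator λ { zero (); (suc _) () }

  leafx∉separator : ∀ {j} → leafx j ∉ separator
  leafx∉separator = ∉separator λ { zero (); (suc _) () }

  -- The value on w and the u i is irrelevant: they lie in the separator.
  starOf : V → Fin (suc r)
  starOf w          = fromℕ r
  starOf (u _)      = fromℕ r
  starOf (ctr i)    = i
  starOf (leaf i _) = inject₁ i
  starOf (leafx _)  = fromℕ r

  starOf-edge : ∀ {b c} → Adj b c → b ∉ separator → c ∉ separator → starOf b ≡ starOf c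
  starOf-edge (inj₁ b→c) b∉ _ = starOf-TEdge b→c b∉
    where
    starOf-TEdge : ∀ {b c} → TEdge b c → b ∉ separator → starOf b ≡ starOf c
    starOf-TEdge (w-u _)         w∉ = contradiction w∈separator w∉
    starOf-TEdge (w-ctr _)       w∉ = contradiction w∈separator w∉
    starOf-TEdge (ctr-leaf _ _)  _  = refl
    starOf-TEdge (ctr-leafx _)   _  = refl
  starOf-edge (inj₂ c→b) b∉ c∉ = sym (starOf-edge (inj₁ c→b) c∉ b∉)

  separator-cutset : Fin r → IsCutset Adj separator
  separator-cutset i =
    ctr (inject₁ i) , ctr (fromℕ r) , ctr∉separator , ctr∉separator ,
    λ reach → fromℕ≢inject₁ (sym (Reach-invariant Adj starOf starOf-edge reach))

  ctr-inject₁-component : ∀ i → ComponentAtLeast Adj (suc g) separator (ctr (inject₁ i))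
  ctr-inject₁-component i =
    star-component Adj ctr∉separator (leaf i) (λ { refl → refl }) (λ _ ())
      (λ j → inj₁ (ctr-leaf i j)) (λ _ → leaf∉separator)

  ctr-fromℕ-component : g ≤ x → ComponentAtLeast Adj (suc g) separator (ctr (fromℕ r))
  ctr-fromℕ-component g≤x =
    star-component Adj ctr∉separator (λ j → leafx (inject≤ j g≤x)) leafx-inject≤-injective (λ _ ())
      (λ _ → inj₁ (ctr-leafx _)) (λ _ → leafx∉separator)
    where
    leafx-inject≤-injective : Injective _≡_ _≡_ (λ j → leafx (inject≤ j g≤x))
    leafx-inject≤-injective {i} {j} eq = inject≤-injective g≤x g≤x i j (leafx-injective eq)
      where
      leafx-injective : ∀ {a b} → _≡_ {A = V} (leafx a) (leafx b) → a ≡ b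
      leafx-injective refl = refl

  separator-components : g ≤ x → ComponentsAtLeast Adj (suc g) separator
  separator-components _ w w∉ = contradiction w∈separator w∉
  separator-components _ (u i) ui∉ = contradiction (∈-tabulate⁺ {f = separatorAt} (suc i)) ui∉
  separator-components g≤x (ctr i) _ with view i
  ... | ‵fromℕ     = ctr-fromℕ-component g≤x
  ... | ‵inject₁ j = ctr-inject₁-component j
  separator-components _ (leaf i j) a∉ =
    ComponentAtLeast-resp-Reach Adj (step (here a∉) (inj₂ (ctr-leaf i j)) ctr∉separator)
      (ctr-inject₁-component i)
  separator-components g≤x (leafx j) a∉ =
    ComponentAtLeast-resp-Reach Adj (step (here a∉) (inj₂ (ctr-leafx j)) ctr∉separator)
      (ctr-fromℕ-component g≤x)

  kappa : 1 ≤ g → g ≤ x → Fin r → KappaIs Adj g (suc m)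
  kappa 1≤g g≤x i =
    (separator , Unique.tabulate⁺ separatorAt-injective , length-tabulate separatorAt ,
     separator-cutset i , separator-components g≤x) ,
    λ _ _ rg → Rg-cutset-length 1≤g rg

≤half⇒double≤ : ∀ {g n} → g ≤ n / 2 → 2 * g ≤ n
≤half⇒double≤ {g} {n} g≤n/2 = begin
  2 * g     ≡⟨ *-comm 2 g ⟩
  g * 2     ≤⟨ *-monoˡ-≤ 2 g≤n/2 ⟩
  n / 2 * 2 ≤⟨ m/n*n≤m n 2 ⟩
  n         ∎
  where open ≤-Reasoning

-- With r = 0 the order would be x + 1 + k ≤ 2g + 1 + k, below the lower bound 2g + 2 + k on n.
some-g-star : ∀ {d g r x} → g ≤ (d ∸ 2) / 2 → g < x → x ≤ 2 * g → d ≡ suc g * r + x + 1 → 1 ≤ r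
some-g-star {r = suc _} _ _ _ _ = s≤s z≤n
some-g-star {d} {g} {zero} {suc x} g≤half _ x≤2g d≡ = contradiction x≤2g (<⇒≱ (begin-strict
  2 * g                     ≤⟨ ≤half⇒double≤ g≤half ⟩
  d ∸ 2                     ≡⟨ cong (_∸ 2) d≡ ⟩
  suc g * 0 + suc x + 1 ∸ 2 ≡⟨ cong (λ t → t + suc x + 1 ∸ 2) (*-zeroʳ (suc g)) ⟩
  suc x + 1 ∸ 2             ≡⟨ cong (_∸ 2) (+-comm (suc x) 1) ⟩
  x                         <⟨ n<1+n x ⟩
  suc x                     ∎))
  where open ≤-Reasoning

lemma5p1 : (n g k r x : ℕ) → 1 ≤ k → 1 ≤ g → g ≤ (n ∸ k ∸ 2) / 2
    → suc g ≤ x → x ≤ 2 * g → n ∸ k ≡ (suc g) * r + x + 1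
    → KappaIs (TAdj {k} {r} {g} {x}) g k
lemma5p1 n g (suc m) r x (s≤s z≤n) 1≤g g≤half g<x x≤2g order =
  Tree.kappa m r g x 1≤g (<⇒≤ g<x) (fromℕ< (some-g-star g≤half g<x x≤2g order))
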